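{- Let $r\ge 1$ and let $T_0<T_1<\dots<T_{r-1}$ be positive integers with $T_k=b_kT_{k-1}$ for integers $b_k\ge 2$ ($k=1,\dots,r-1$); put $w=T_0$ and $B_k=\prod_{m=1}^{k}b_m$ (so $B_0=1$ and $T_k=B_kw$). Consider jobs $J_1,\dots,J_n$, where job $J_i$ has a positive integer processing time $p_i$ and period $T_{\pi_i}$ with $\pi_i\in\{0,\dots,r-1\}$. A periodic schedule assigns to each job $J_i$ integers $u_i,v_i$ with $0\le u_i$, $u_i+p_i\le w$ and $0\le v_i<B_{\pi_i}$; job $J_i$ then has start offset $s_i=u_i+v_iw$ and its occurrences are the time intervals $[s_i+kT_{\pi_i},\,s_i+kT_{\pi_i}+p_i)$ for all integers $k\ge 0$. Two distinct jobs $J_i,J_j$ collide if some occurrence of $J_i$ and some occurrence of $J_j$ have nonempty intersection. Then for two distinct jobs $J_i,J_j$ with $\pi_i\le\pi_j$, the schedule induces a collision between $J_i$ and $J_j$ if and only if both of the following hold: (1) $u_i<u_j+p_j$ and $u_j<u_i+p_i$; (2) there exists an integer $\kappa$ with $0\le \kappa<B_{\pi_j}/B_{\pi_i}$ such that $v_j=v_i+\kappa B_{\pi_i}$.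
   Context: This is the single-machine non-preemptive strictly periodic scheduling setting with a harmonic set of periods; the time origin is normalized so that every start offset decomposes as $s_i=u_i+v_iw$ with $w$ the least period, $u_i+p_i\le w$, and $0\le s_i<T_{\pi_i}$. -}

module Defs where

open import Data.Nat using (ℕ; zero; suc; _+_; _*_; _∸_; _<_; _≤_)
open import Data.Fin using (Fin; toℕ)
open import Data.Product using (_×_; ∃-syntax)

-- ∏_{m = lo+1}^{lo+d} b m   (empty product = 1)
prodFrom : (ℕ → ℕ) → ℕ → ℕ → ℕ
prodFrom b lo zero    = 1
prodFrom b lo (suc d) = prodFrom b lo d * b (lo + suc d)

B : (ℕ → ℕ) → ℕ → ℕ
B b k = prodFrom b 0 k

T : (ℕ → ℕ) → ℕ → ℕ → ℕ
T b w k = B b k * w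

Overlap : ℕ → ℕ → ℕ → ℕ → Set
Overlap a p c q = (a < c + q) × (c < a + p)

startOf : (w : ℕ) → (u v : ℕ) → ℕ
startOf w u v = u + v * w

Collide : {n r : ℕ} → (b : ℕ → ℕ) → (w : ℕ) → (p : Fin n → ℕ) → (π : Fin n → Fin r)
        → (u v : Fin n → ℕ) → Fin n → Fin n → Set
Collide b w p π u v i j =
  ∃[ k ] ∃[ l ]
    Overlap (startOf w (u i) (v i) + k * T b w (toℕ (π i))) (p i)
            (startOf w (u j) (v j) + l * T b w (toℕ (π j))) (p j)

-- Since u + p ≤ w, every occurrence of a job lies inside a single window [X w, (X + 1) w),
-- and the k-th occurrence of J_i starts at u_i + (v_i + k B_i) w. Two occurrences can therefore
-- meet only inside a common window, where they meet iff [u_i, u_i + p_i) and [u_j, u_j + p_j) do;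
-- and the window indices v_i + k B_i and v_j + l B_j (with B_j = B_i P) agree for some k, l
-- iff v_j ≡ v_i modulo B_i, i.e. v_j = v_i + κ B_i with κ < P because v_j < B_j.
module Submission where

open import Defs
open import Data.Nat using (ℕ; zero; suc; _+_; _*_; _∸_; _<_; _≤_)
open import Data.Nat.Properties
open import Data.Nat.Solver using (module +-*-Solver)
open import Data.Fin using (Fin; toℕ)
open import Data.Product using (_×_; _,_; ∃-syntax; map)
open import Relation.Binary.PropositionalEquality
open import Relation.Binary.Definitions using (tri<; tri≈; tri>)
open import Relation.Nullary using (contradiction)
open import Function.Base using (id)
open import Function.Bundles using (_⇔_; mk⇔; Equivalence)
open import Algebra.Properties.CommutativeSemigroup +-commutativeSemigroup using (xy∙z≈xz∙y)

open +-*-Solver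

prodFrom-+ : ∀ (b : ℕ → ℕ) lo m d →
  prodFrom b lo (m + d) ≡ prodFrom b lo m * prodFrom b (lo + m) d
prodFrom-+ b lo m zero = trans (cong (prodFrom b lo) (+-identityʳ m)) (sym (*-identityʳ _))
prodFrom-+ b lo m (suc d) = begin
  prodFrom b lo (m + suc d)                         ≡⟨ cong (prodFrom b lo) (+-suc m d) ⟩
  prodFrom b lo (m + d) * b (lo + suc (m + d))      ≡⟨ cong₂ _*_ (prodFrom-+ b lo m d) index ⟩
  (L * R) * b (lo + m + suc d)                      ≡⟨ *-assoc L R (b (lo + m + suc d)) ⟩
  L * (R * b (lo + m + suc d))                      ∎
  where
  open ≡-Reasoning
  L R : ℕ
  L = prodFrom b lo m
  R = prodFrom b (lo + m) d
  index : b (lo + suc (m + d)) ≡ b (lo + m + suc d)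
  index = cong b (trans (cong (lo +_) (sym (+-suc m d))) (sym (+-assoc lo m (suc d))))

B-split : ∀ (b : ℕ → ℕ) {m n} → m ≤ n → B b n ≡ B b m * prodFrom b m (n ∸ m)
B-split b {m} {n} m≤n = trans (cong (B b) (sym (m+[n∸m]≡n m≤n))) (prodFrom-+ b 0 m (n ∸ m))

Overlap-+ʳ : ∀ a p c q x → Overlap (a + x) p (c + x) q ⇔ Overlap a p c q
Overlap-+ʳ a p c q x = mk⇔ (map (cancel a c q) (cancel c a p)) (map (shift a c q) (shift c a p))
  where
  cancel : ∀ a c q → a + x < c + x + q → a < c + q
  cancel a c q h = +-cancelʳ-< x a (c + q) (subst (a + x <_) (xy∙z≈xz∙y c x q) h)
  shift : ∀ a c q → a < c + q → a + x < c + x + q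
  shift a c q h = subst (a + x <_) (sym (xy∙z≈xz∙y c x q)) (+-monoˡ-< x h)

startOf-+-period : ∀ w u v k d → startOf w u v + k * (d * w) ≡ startOf w u (v + k * d)
startOf-+-period = solve 5 (λ w u v k d → u :+ v :* w :+ k :* (d :* w) := u :+ (v :+ k :* d) :* w) refl

window-end≤ : ∀ {u p u′ w X Y} → u + p ≤ w → X < Y → startOf w u X + p ≤ startOf w u′ Y
window-end≤ {u} {p} {u′} {w} {X} {Y} u+p≤w X<Y = begin
  u + X * w + p    ≡⟨ xy∙z≈xz∙y u (X * w) p ⟩
  u + p + X * w    ≤⟨ +-monoˡ-≤ (X * w) u+p≤w ⟩
  suc X * w        ≤⟨ *-monoˡ-≤ w X<Y ⟩
  Y * w            ≤⟨ m≤n+m (Y * w) u′ ⟩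
  u′ + Y * w       ∎
  where open ≤-Reasoning

Overlap-windows⇔ : ∀ {u p u′ q w X Y} → u + p ≤ w → u′ + q ≤ w →
  Overlap (startOf w u X) p (startOf w u′ Y) q ⇔ (Overlap u p u′ q × X ≡ Y)
Overlap-windows⇔ {u} {p} {u′} {q} {w} {X} {Y} u+p≤w u′+q≤w = mk⇔ to from
  where
  same-window : Overlap (startOf w u X) p (startOf w u′ Y) q → X ≡ Y
  same-window (o₁ , o₂) with <-cmp X Y
  ... | tri< X<Y _ _ = contradiction (window-end≤ {u} {p} {u′} u+p≤w X<Y) (<⇒≱ o₂)
  ... | tri≈ _ X≡Y _ = X≡Y
  ... | tri> _ _ Y<X = contradiction (window-end≤ {u′} {q} {u} u′+q≤w Y<X) (<⇒≱ o₁)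

  to : Overlap (startOf w u X) p (startOf w u′ Y) q → Overlap u p u′ q × X ≡ Y
  to o with refl ← same-window o = Equivalence.to (Overlap-+ʳ u p u′ q (X * w)) o , refl

  from : Overlap u p u′ q × X ≡ Y → Overlap (startOf w u X) p (startOf w u′ Y) q
  from (o , refl) = Equivalence.from (Overlap-+ʳ u p u′ q (X * w)) o

quotient-≤ : ∀ {v v′ d k m} → v < d → v + k * d ≡ v′ + m * d → m ≤ k
quotient-≤ {v} {v′} {d} {k} {m} v<d e = ≮⇒≥ λ k<m → <-irrefl e (begin-strict
  v + k * d     <⟨ +-monoˡ-< (k * d) v<d ⟩
  suc k * d     ≤⟨ *-monoˡ-≤ d k<m ⟩
  m * d         ≤⟨ m≤n+m (m * d) v′ ⟩
  v′ + m * d    ∎)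
  where open ≤-Reasoning

≡-mod⇒residue : ∀ {vᵢ vⱼ d P k l} → vᵢ < d → vⱼ < d * P →
  vᵢ + k * d ≡ vⱼ + l * (d * P) → ∃[ κ ] (κ < P × vⱼ ≡ vᵢ + κ * d)
≡-mod⇒residue {vᵢ} {vⱼ} {d} {P} {k} {l} vᵢ<d vⱼ<dP e = κ , κ<P , vⱼ≡
  where
  m : ℕ
  m = l * P
  e′ : vᵢ + k * d ≡ vⱼ + m * d
  e′ = trans e (cong (vⱼ +_) (trans (cong (l *_) (*-comm d P)) (sym (*-assoc l P d))))
  κ : ℕ
  κ = k ∸ m
  k≡ : k ≡ m + κ
  k≡ = sym (m+[n∸m]≡n (quotient-≤ {vᵢ} {vⱼ} {d} {k} {m} vᵢ<d e′))
  vⱼ≡ : vⱼ ≡ vᵢ + κ * d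
  vⱼ≡ = +-cancelʳ-≡ (m * d) vⱼ (vᵢ + κ * d) (begin
    vⱼ + m * d            ≡⟨ sym e′ ⟩
    vᵢ + k * d            ≡⟨ cong (λ k → vᵢ + k * d) k≡ ⟩
    vᵢ + (m + κ) * d      ≡⟨ solve 4 (λ vᵢ m κ d → vᵢ :+ (m :+ κ) :* d := vᵢ :+ κ :* d :+ m :* d) refl vᵢ m κ d ⟩
    vᵢ + κ * d + m * d    ∎)
    where open ≡-Reasoning
  κ<P : κ < P
  κ<P = *-cancelʳ-< d κ P (begin-strict
    κ * d          ≤⟨ m≤n+m (κ * d) vᵢ ⟩
    vᵢ + κ * d     ≡⟨ sym vⱼ≡ ⟩
    vⱼ             <⟨ vⱼ<dP ⟩
    d * P          ≡⟨ *-comm d P ⟩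
    P * d          ∎)
    where open ≤-Reasoning

periodic-Overlap⇔ : ∀ {w uᵢ pᵢ vᵢ dᵢ uⱼ pⱼ vⱼ dⱼ P} → dⱼ ≡ dᵢ * P →
  uᵢ + pᵢ ≤ w → uⱼ + pⱼ ≤ w → vᵢ < dᵢ → vⱼ < dⱼ →
  (∃[ k ] ∃[ l ] Overlap (startOf w uᵢ vᵢ + k * (dᵢ * w)) pᵢ (startOf w uⱼ vⱼ + l * (dⱼ * w)) pⱼ)
  ⇔ (Overlap uᵢ pᵢ uⱼ pⱼ × ∃[ κ ] (κ < P × vⱼ ≡ vᵢ + κ * dᵢ))
periodic-Overlap⇔ {w} {uᵢ} {pᵢ} {vᵢ} {dᵢ} {uⱼ} {pⱼ} {vⱼ} {dⱼ} {P} refl uᵢ+pᵢ≤w uⱼ+pⱼ≤w vᵢ<dᵢ vⱼ<dⱼ =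
  mk⇔ to from
  where
  windows : ∀ k l → Overlap (startOf w uᵢ (vᵢ + k * dᵢ)) pᵢ (startOf w uⱼ (vⱼ + l * dⱼ)) pⱼ
                  ⇔ (Overlap uᵢ pᵢ uⱼ pⱼ × vᵢ + k * dᵢ ≡ vⱼ + l * dⱼ)
  windows k l = Overlap-windows⇔ uᵢ+pᵢ≤w uⱼ+pⱼ≤w

  occurrences : ∀ k l → Overlap (startOf w uᵢ vᵢ + k * (dᵢ * w)) pᵢ (startOf w uⱼ vⱼ + l * (dⱼ * w)) pⱼ
                      ≡ Overlap (startOf w uᵢ (vᵢ + k * dᵢ)) pᵢ (startOf w uⱼ (vⱼ + l * dⱼ)) pⱼ
  occurrences k l = cong₂ (λ s t → Overlap s pᵢ t pⱼ)
    (startOf-+-period w uᵢ vᵢ k dᵢ) (startOf-+-period w uⱼ vⱼ l dⱼ)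

  to : (∃[ k ] ∃[ l ] Overlap (startOf w uᵢ vᵢ + k * (dᵢ * w)) pᵢ (startOf w uⱼ vⱼ + l * (dⱼ * w)) pⱼ)
     → Overlap uᵢ pᵢ uⱼ pⱼ × ∃[ κ ] (κ < P × vⱼ ≡ vᵢ + κ * dᵢ)
  to (k , l , o) with Equivalence.to (windows k l) (subst id (occurrences k l) o)
  ... | o′ , e = o′ , ≡-mod⇒residue {k = k} {l} vᵢ<dᵢ vⱼ<dⱼ e

  from : Overlap uᵢ pᵢ uⱼ pⱼ × ∃[ κ ] (κ < P × vⱼ ≡ vᵢ + κ * dᵢ)
       → ∃[ k ] ∃[ l ] Overlap (startOf w uᵢ vᵢ + k * (dᵢ * w)) pᵢ (startOf w uⱼ vⱼ + l * (dⱼ * w)) pⱼ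
  from (o , κ , _ , vⱼ≡) = κ , 0 , subst id (sym (occurrences κ 0))
    (Equivalence.from (windows κ 0) (o , trans (sym vⱼ≡) (sym (+-identityʳ vⱼ))))

lemma1 : (r : ℕ) → 1 ≤ r
    → (w : ℕ) → 1 ≤ w
    → (b : ℕ → ℕ) → (∀ k → 1 ≤ k → k < r → 2 ≤ b k)
    → (n : ℕ) → (p : Fin n → ℕ) → (∀ i → 1 ≤ p i)
    → (π : Fin n → Fin r)
    → (u v : Fin n → ℕ)
    → (∀ i → u i + p i ≤ w)
    → (∀ i → v i < B b (toℕ (π i)))
    → (i j : Fin n) → i ≢ j → toℕ (π i) ≤ toℕ (π j)
    → Collide b w p π u v i j
      ⇔ ((u i < u j + p j × u j < u i + p i)
         × ∃[ κ ] (κ < prodFrom b (toℕ (π i)) (toℕ (π j) ∸ toℕ (π i))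
                   × v j ≡ v i + κ * B b (toℕ (π i))))
lemma1 r _ w _ b _ n p _ π u v u+p≤w v<B i j _ πᵢ≤πⱼ =
  periodic-Overlap⇔ (B-split b πᵢ≤πⱼ) (u+p≤w i) (u+p≤w j) (v<B i) (v<B j)
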